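{- For every integer $n\ge 1$ there exists an $n\times n$ alternating sign matrix $A$ with term rank $\rho(A)=\left\lceil 2\sqrt{n+1}-2\right\rceil$.
   Context: An alternating sign matrix (ASM) is an $n\times n$ matrix with entries in $\{0,+1,-1\}$ such that in each row and each column the nonzero entries alternate in sign, beginning and ending with $+1$. The term rank $\rho(X)$ of a matrix $X$ is the maximum number of nonzero entries of $X$ no two of which lie in the same row or column. -}

module Defs where

open import Data.Nat using (ℕ; _+_; _*_; _≤_)
open import Data.Integer as ℤ using (ℤ; +_; -[1+_])
open import Data.Fin using (Fin)
open import Data.List using (List; []; _∷_; map; filter; allFin)
open import Data.Product using (Σ; _×_)
open import Data.Sum using (_⊎_)
open import Function.Definitions using (Injective)
open import Relation.Binary.PropositionalEquality using (_≡_; _≢_)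
open import Relation.Nullary.Decidable using (¬?)

Matrix : ℕ → Set
Matrix n = Fin n → Fin n → ℤ

Entry01 : ℤ → Set
Entry01 x = (x ≡ + 0) ⊎ ((x ≡ + 1) ⊎ (x ≡ -[1+ 0 ]))

data Alternating : List ℤ → Set where
  single : Alternating (+ 1 ∷ [])
  step   : ∀ {xs} → Alternating xs → Alternating (+ 1 ∷ -[1+ 0 ] ∷ xs)

nonzeros : List ℤ → List ℤ
nonzeros = filter (λ x → ¬? (x ℤ.≟ + 0))

row : ∀ {n} → Matrix n → Fin n → List ℤ
row {n} A i = map (λ j → A i j) (allFin n)

col : ∀ {n} → Matrix n → Fin n → List ℤ
col {n} A j = map (λ i → A i j) (allFin n)

record IsASM {n : ℕ} (A : Matrix n) : Set where
  field
    entries : ∀ i j → Entry01 (A i j)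
    rows    : ∀ i → Alternating (nonzeros (row A i))
    cols    : ∀ j → Alternating (nonzeros (col A j))

IndependentNonzeros : ∀ {n} → Matrix n → ℕ → Set
IndependentNonzeros {n} A k =
  Σ (Fin k → Fin n) λ r → Σ (Fin k → Fin n) λ c →
    Injective _≡_ _≡_ r × Injective _≡_ _≡_ c × (∀ t → A (r t) (c t) ≢ + 0)

record HasTermRank {n : ℕ} (A : Matrix n) (m : ℕ) : Set where
  field
    attained : IndependentNonzeros A m
    maximal  : ∀ k → IndependentNonzeros A k → k ≤ m

-- m = ⌈ 2 √(n+1) - 2 ⌉ (for n ≥ 1 this is a natural number), characterised
-- without reals: m is the least natural number with m + 2 ≥ 2 √(n+1),
-- i.e. with 4 (n+1) ≤ (m+2)^2.
IsCeil2Sqrt : ℕ → ℕ → Set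
IsCeil2Sqrt n m =
  (4 * (n + 1) ≤ (m + 2) * (m + 2)) ×
  (∀ k → 4 * (n + 1) ≤ (k + 2) * (k + 2) → m ≤ k)

-- Write m = a + b with a = ⌊m/2⌋ and b = ⌈m/2⌉; the hypothesis on m gives a + b ≤ n ≤ a + b + ab.
-- Index the rows and the columns by one set K of pairs (u , v) with u ≤ a and v ≤ b: all the axis
-- pairs (u , 0) and (0 , v) other than (0 , 0), and n − a − b interior pairs with u, v ≥ 1. Rows
-- list K lexicographically, columns list it with v as the major coordinate. Row (u , 0) has +1 in
-- every column (u , v) and −1 in column (0 , v) whenever (u , v) is interior, so in column order it
-- reads +1, then −1 +1 for each interior (u , v); a row (u , v) with v ≥ 1 has a single +1, in
-- column (0 , v). Swapping the coordinates (and a with b) transposes the matrix, so the columns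
-- alternate as well. All nonzero entries lie in the a rows (u , 0) and the b columns (0 , v), which
-- bounds the term rank by a + b, and the diagonal entries at the axis pairs attain it.

module Submission where

open import Defs
open import Data.Nat using (ℕ; _≤_)
open import Data.Product using (Σ; _×_)

open import Data.Bool using (Bool; true; false; T; if_then_else_)
open import Data.Empty using (⊥-elim)
open import Data.Fin as Fin using (Fin; splitAt; join; toℕ; fromℕ<)
import Data.Fin.Properties as Finₚ
open import Data.Integer as ℤ using (ℤ; +_; -[1+_])
open import Data.List
  using (List; []; _∷_; [_]; _++_; map; filterᵇ; length; allFin; tabulate; concatMap; cartesianProduct; upTo)
import Data.List.Properties as List
open import Data.List.Membership.Propositional using (_∈_)
open import Data.List.Membership.Propositional.Properties
  using (∈-filter⁺; ∈-filter⁻; ∈-cartesianProduct⁺; ∈-cartesianProduct⁻; ∈-upTo⁺; ∈-upTo⁻; ∈-map⁺; ∈-map⁻)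
open import Data.List.Membership.Propositional.Properties.WithK using (unique∧set⇒bag)
open import Data.List.Relation.Binary.BagAndSetEquality using (∼bag⇒↭)
open import Data.List.Relation.Binary.Permutation.Propositional.Properties using (↭-length)
open import Data.List.Relation.Unary.All as All using (All)
import Data.List.Relation.Unary.All.Properties as All
open import Data.List.Relation.Unary.Any using (here; there)
open import Data.List.Relation.Unary.Unique.Propositional using (Unique; []; _∷_)
import Data.List.Relation.Unary.Unique.Propositional.Properties as Unique
open import Data.Nat using (zero; suc; _+_; _*_; _∸_; _⊓_; _<_; _<ᵇ_; z≤n; s≤s)
open import Data.Nat.ListAction using (sum)
open import Data.Nat.Properties
open import Data.Nat.Solver using (module +-*-Solver)
open import Data.Product using (∃; _,_; proj₁; proj₂; swap)
open import Data.Sum using (_⊎_; inj₁; inj₂)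
open import Data.Unit using (tt)
open import Function.Base using (_∘_; flip; case_of_)
open import Function.Bundles using (mk⇔)
open import Function.Definitions using (Injective)
open import Relation.Binary.PropositionalEquality hiding ([_])
open import Relation.Nullary.Decidable using (T?; ¬?)

open +-*-Solver

private
  variable
    X Y Z : Set

unique∧sameMembers⇒length≡ : {xs ys : List X} → Unique xs → Unique ys →
  (∀ {x} → x ∈ xs → x ∈ ys) → (∀ {x} → x ∈ ys → x ∈ xs) → length xs ≡ length ys
unique∧sameMembers⇒length≡ uxs uys to from =
  ↭-length (∼bag⇒↭ (unique∧set⇒bag uxs uys (mk⇔ to from)))

filterᵇ-map : (k : Y → Bool) (f : X → Y) (xs : List X) →
  filterᵇ k (map f xs) ≡ map f (filterᵇ (k ∘ f) xs)
filterᵇ-map k f []       = refl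
filterᵇ-map k f (x ∷ xs) with k (f x)
... | true  = cong (f x ∷_) (filterᵇ-map k f xs)
... | false = filterᵇ-map k f xs

map-filterᵇ-cartesianProduct : (h : X × Y → Z) (k : X × Y → Bool) (xs : List X) (ys : List Y) →
  map h (filterᵇ k (cartesianProduct xs ys)) ≡
  concatMap (λ x → map (h ∘ (x ,_)) (filterᵇ (k ∘ (x ,_)) ys)) xs
map-filterᵇ-cartesianProduct h k []       ys = refl
map-filterᵇ-cartesianProduct h k (x ∷ xs) ys = begin
  map h (filterᵇ k (map (x ,_) ys ++ cartesianProduct xs ys))
    ≡⟨ cong (map h) (List.filter-++ (T? ∘ k) (map (x ,_) ys) _) ⟩
  map h (filterᵇ k (map (x ,_) ys) ++ filterᵇ k (cartesianProduct xs ys))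
    ≡⟨ List.map-++ h (filterᵇ k (map (x ,_) ys)) _ ⟩
  map h (filterᵇ k (map (x ,_) ys)) ++ map h (filterᵇ k (cartesianProduct xs ys))
    ≡⟨ cong₂ _++_ block (map-filterᵇ-cartesianProduct h k xs ys) ⟩
  map (h ∘ (x ,_)) (filterᵇ (k ∘ (x ,_)) ys) ++ concatMap (λ x → map (h ∘ (x ,_)) (filterᵇ (k ∘ (x ,_)) ys)) xs ∎
  where
    open ≡-Reasoning
    block : map h (filterᵇ k (map (x ,_) ys)) ≡ map (h ∘ (x ,_)) (filterᵇ (k ∘ (x ,_)) ys)
    block = trans (cong (map h) (filterᵇ-map k (x ,_) ys)) (sym (List.map-∘ _))

length-filterᵇ-cartesianProduct : (k : X × Y → Bool) (xs : List X) (ys : List Y) →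
  length (filterᵇ k (cartesianProduct xs ys)) ≡ sum (map (λ x → length (filterᵇ (k ∘ (x ,_)) ys)) xs)
length-filterᵇ-cartesianProduct k []       ys = refl
length-filterᵇ-cartesianProduct k (x ∷ xs) ys = begin
  length (filterᵇ k (map (x ,_) ys ++ cartesianProduct xs ys))
    ≡⟨ cong length (List.filter-++ (T? ∘ k) (map (x ,_) ys) _) ⟩
  length (filterᵇ k (map (x ,_) ys) ++ filterᵇ k (cartesianProduct xs ys))
    ≡⟨ List.length-++ (filterᵇ k (map (x ,_) ys)) ⟩
  length (filterᵇ k (map (x ,_) ys)) + length (filterᵇ k (cartesianProduct xs ys))
    ≡⟨ cong₂ _+_ block (length-filterᵇ-cartesianProduct k xs ys) ⟩
  length (filterᵇ (k ∘ (x ,_)) ys) + sum (map (λ x → length (filterᵇ (k ∘ (x ,_)) ys)) xs) ∎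
  where
    open ≡-Reasoning
    block : length (filterᵇ k (map (x ,_) ys)) ≡ length (filterᵇ (k ∘ (x ,_)) ys)
    block = trans (cong length (filterᵇ-map k (x ,_) ys)) (List.length-map (x ,_) (filterᵇ (k ∘ (x ,_)) ys))

upTo-suc : ∀ n → upTo (suc n) ≡ 0 ∷ map suc (upTo n)
upTo-suc n = cong (0 ∷_) (sym (List.map-upTo suc n))

filterᵇ-upTo-suc : (k : ℕ → Bool) (n : ℕ) →
  filterᵇ k (upTo (suc n)) ≡ filterᵇ k [ 0 ] ++ map suc (filterᵇ (k ∘ suc) (upTo n))
filterᵇ-upTo-suc k n = begin
  filterᵇ k (upTo (suc n))                          ≡⟨ cong (filterᵇ k) (upTo-suc n) ⟩
  filterᵇ k ([ 0 ] ++ map suc (upTo n))             ≡⟨ List.filter-++ (T? ∘ k) [ 0 ] (map suc (upTo n)) ⟩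
  filterᵇ k [ 0 ] ++ filterᵇ k (map suc (upTo n))   ≡⟨ cong (filterᵇ k [ 0 ] ++_) (filterᵇ-map k suc (upTo n)) ⟩
  filterᵇ k [ 0 ] ++ map suc (filterᵇ (k ∘ suc) (upTo n)) ∎
  where open ≡-Reasoning

map-filterᵇ-upTo-suc : (f : ℕ → X) (k : ℕ → Bool) (n : ℕ) →
  map f (filterᵇ k (upTo (suc n))) ≡ map f (filterᵇ k [ 0 ]) ++ map (f ∘ suc) (filterᵇ (k ∘ suc) (upTo n))
map-filterᵇ-upTo-suc f k n = begin
  map f (filterᵇ k (upTo (suc n)))
    ≡⟨ cong (map f) (filterᵇ-upTo-suc k n) ⟩
  map f (filterᵇ k [ 0 ] ++ map suc (filterᵇ (k ∘ suc) (upTo n)))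
    ≡⟨ List.map-++ f (filterᵇ k [ 0 ]) _ ⟩
  map f (filterᵇ k [ 0 ]) ++ map f (map suc (filterᵇ (k ∘ suc) (upTo n)))
    ≡⟨ cong (map f (filterᵇ k [ 0 ]) ++_) (sym (List.map-∘ _)) ⟩
  map f (filterᵇ k [ 0 ]) ++ map (f ∘ suc) (filterᵇ (k ∘ suc) (upTo n)) ∎
  where open ≡-Reasoning

length-filterᵇ-upTo-suc : (k : ℕ → Bool) (n : ℕ) →
  length (filterᵇ k (upTo (suc n))) ≡ length (filterᵇ k [ 0 ]) + length (filterᵇ (k ∘ suc) (upTo n))
length-filterᵇ-upTo-suc k n = begin
  length (filterᵇ k (upTo (suc n)))
    ≡⟨ cong length (filterᵇ-upTo-suc k n) ⟩
  length (filterᵇ k [ 0 ] ++ map suc (filterᵇ (k ∘ suc) (upTo n)))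
    ≡⟨ List.length-++ (filterᵇ k [ 0 ]) ⟩
  length (filterᵇ k [ 0 ]) + length (map suc (filterᵇ (k ∘ suc) (upTo n)))
    ≡⟨ cong (_+_ (length (filterᵇ k [ 0 ]))) (List.length-map suc (filterᵇ (k ∘ suc) (upTo n))) ⟩
  length (filterᵇ k [ 0 ]) + length (filterᵇ (k ∘ suc) (upTo n)) ∎
  where open ≡-Reasoning

filterᵇ-<ᵇ-upTo : ∀ {c b} → c ≤ b → filterᵇ (_<ᵇ c) (upTo b) ≡ upTo c
filterᵇ-<ᵇ-upTo {zero}  {b}     _         = List.filter-none (T? ∘ (_<ᵇ 0)) (All.universal (λ _ ()) (upTo b))
filterᵇ-<ᵇ-upTo {suc c} {suc b} (s≤s c≤b) = begin
  filterᵇ (_<ᵇ suc c) (upTo (suc b))       ≡⟨ filterᵇ-upTo-suc (_<ᵇ suc c) b ⟩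
  0 ∷ map suc (filterᵇ (_<ᵇ c) (upTo b))   ≡⟨ cong (λ xs → 0 ∷ map suc xs) (filterᵇ-<ᵇ-upTo c≤b) ⟩
  0 ∷ map suc (upTo c)                     ≡⟨ upTo-suc c ⟨
  upTo (suc c)                             ∎
  where open ≡-Reasoning

sum-map-suc : (f : X → ℕ) (xs : List X) → sum (map (suc ∘ f) xs) ≡ length xs + sum (map f xs)
sum-map-suc f []       = refl
sum-map-suc f (x ∷ xs) = trans (cong (suc ∘ _+_ (f x)) (sum-map-suc f xs))
  (solve 3 (λ p q r → con 1 :+ (p :+ (q :+ r)) := con 1 :+ (q :+ (p :+ r))) refl (f x) (length xs) (sum (map f xs)))

nonzeros-++ : ∀ xs ys → nonzeros (xs ++ ys) ≡ nonzeros xs ++ nonzeros ys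
nonzeros-++ = List.filter-++ (λ x → ¬? (x ℤ.≟ + 0))

nonzeros-concatMap : (f : X → List ℤ) (xs : List X) →
  nonzeros (concatMap f xs) ≡ concatMap (nonzeros ∘ f) xs
nonzeros-concatMap f []       = refl
nonzeros-concatMap f (x ∷ xs) =
  trans (nonzeros-++ (f x) (concatMap f xs)) (cong (nonzeros (f x) ++_) (nonzeros-concatMap f xs))

nonzeros-map-zero : (h : X → ℤ) {xs : List X} →
  All (λ x → h x ≡ + 0) xs → nonzeros (map h xs) ≡ []
nonzeros-map-zero h zeros =
  List.filter-none (λ x → ¬? (x ℤ.≟ + 0)) (All.map⁺ (All.map (λ hx≡0 hx≢0 → hx≢0 hx≡0) zeros))

nonzeros-map-single : (h : X → ℤ) {x₀ : X} {xs : List X} → Unique xs → x₀ ∈ xs →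
  (∀ x → x ≢ x₀ → h x ≡ + 0) → nonzeros (map h xs) ≡ nonzeros [ h x₀ ]
nonzeros-map-single h {x₀} {_ ∷ xs} (x₀∉xs ∷ _) (here refl) vanishes = begin
  nonzeros ([ h x₀ ] ++ map h xs)          ≡⟨ nonzeros-++ [ h x₀ ] (map h xs) ⟩
  nonzeros [ h x₀ ] ++ nonzeros (map h xs) ≡⟨ cong (nonzeros [ h x₀ ] ++_) (nonzeros-map-zero h xs≡0) ⟩
  nonzeros [ h x₀ ] ++ []                  ≡⟨ List.++-identityʳ _ ⟩
  nonzeros [ h x₀ ]                        ∎
  where
    open ≡-Reasoning
    xs≡0 : All (λ x → h x ≡ + 0) xs
    xs≡0 = All.map (λ x₀≢x → vanishes _ (x₀≢x ∘ sym)) x₀∉xs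
nonzeros-map-single h {x₀} (x∉xs ∷ unique) (there x₀∈xs) vanishes
  rewrite vanishes _ (All.lookup x∉xs x₀∈xs) = nonzeros-map-single h unique x₀∈xs vanishes

signPair : Bool → List ℤ
signPair true  = -[1+ 0 ] ∷ + 1 ∷ []
signPair false = []

alternating-signPairs : (f : X → Bool) (xs : List X) → Alternating (+ 1 ∷ concatMap (signPair ∘ f) xs)
alternating-signPairs f []       = single
alternating-signPairs f (x ∷ xs) with f x
... | true  = step (alternating-signPairs f xs)
... | false = alternating-signPairs f xs

lookupAt : ∀ {n} (xs : List X) → length xs ≡ n → Fin n → X
lookupAt (x ∷ xs) refl Fin.zero    = x
lookupAt (x ∷ xs) refl (Fin.suc i) = lookupAt xs refl i

lookupAt-∈ : ∀ {n} {xs : List X} (len : length xs ≡ n) i → lookupAt xs len i ∈ xs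
lookupAt-∈ {xs = _ ∷ _} refl Fin.zero    = here refl
lookupAt-∈ {xs = _ ∷ _} refl (Fin.suc i) = there (lookupAt-∈ refl i)

∈⇒lookupAt : ∀ {n} {x : X} {xs : List X} (len : length xs ≡ n) → x ∈ xs →
  ∃ λ i → lookupAt xs len i ≡ x
∈⇒lookupAt refl (here refl) = Fin.zero , refl
∈⇒lookupAt refl (there x∈xs) = let i , eq = ∈⇒lookupAt refl x∈xs in Fin.suc i , eq

lookupAt-injective : ∀ {n} {xs : List X} (len : length xs ≡ n) → Unique xs →
  Injective _≡_ _≡_ (lookupAt xs len)
lookupAt-injective refl (_ ∷ _) {Fin.zero} {Fin.zero} _ = refl
lookupAt-injective refl (x∉xs ∷ _) {Fin.zero} {Fin.suc j} eq = ⊥-elim (All.lookup x∉xs (lookupAt-∈ refl j) eq)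
lookupAt-injective refl (x∉xs ∷ _) {Fin.suc i} {Fin.zero} eq = ⊥-elim (All.lookup x∉xs (lookupAt-∈ refl i) (sym eq))
lookupAt-injective refl (_ ∷ unique) {Fin.suc i} {Fin.suc j} eq = cong Fin.suc (lookupAt-injective refl unique eq)

tabulate-lookupAt : ∀ {n} (xs : List X) (len : length xs ≡ n) (h : X → Y) →
  tabulate (h ∘ lookupAt xs len) ≡ map h xs
tabulate-lookupAt []       refl h = refl
tabulate-lookupAt (x ∷ xs) refl h = cong (h x ∷_) (tabulate-lookupAt xs refl h)

map-lookupAt : ∀ {n} (xs : List X) (len : length xs ≡ n) (h : X → Y) →
  map (h ∘ lookupAt xs len) (allFin n) ≡ map h xs
map-lookupAt xs len h = trans (List.map-tabulate (λ i → i) _) (tabulate-lookupAt xs len h)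

CoveredByLines : ∀ {n} → Matrix n → ℕ → ℕ → Set
CoveredByLines {n} A a b =
  Σ (Fin a → Fin n) λ rowLine → Σ (Fin b → Fin n) λ colLine →
    ∀ i j → A i j ≢ + 0 → (∃ λ g → rowLine g ≡ i) ⊎ (∃ λ h → colLine h ≡ j)

join-injective : ∀ a b → Injective _≡_ _≡_ (join a b)
join-injective a b {s} {s′} eq = begin
  s                        ≡⟨ Finₚ.splitAt-join a b s ⟨
  splitAt a (join a b s)   ≡⟨ cong (splitAt a) eq ⟩
  splitAt a (join a b s′)  ≡⟨ Finₚ.splitAt-join a b s′ ⟩
  s′                       ∎
  where open ≡-Reasoning

independent≤lines : ∀ {n} {A : Matrix n} {a b k} →
  CoveredByLines A a b → IndependentNonzeros A k → k ≤ a + b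
independent≤lines {a = a} {b} {k} (rowLine , colLine , cover) (r , c , r-inj , c-inj , nonzero) =
  Finₚ.injective⇒≤ (line-injective ∘ join-injective a b)
  where
    OnLine : Fin k → Fin a ⊎ Fin b → Set
    OnLine t (inj₁ g) = rowLine g ≡ r t
    OnLine t (inj₂ h) = colLine h ≡ c t

    lineThrough : ∀ t → ∃ (OnLine t)
    lineThrough t with cover (r t) (c t) (nonzero t)
    ... | inj₁ (g , eq) = inj₁ g , eq
    ... | inj₂ (h , eq) = inj₂ h , eq

    sameLine⇒≡ : ∀ {t t′} s → OnLine t s → OnLine t′ s → t ≡ t′
    sameLine⇒≡ (inj₁ g) p q = r-inj (trans (sym p) q)
    sameLine⇒≡ (inj₂ h) p q = c-inj (trans (sym p) q)

    line-injective : Injective _≡_ _≡_ (proj₁ ∘ lineThrough)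
    line-injective {t} {t′} eq =
      sameLine⇒≡ (proj₁ (lineThrough t′)) (subst (OnLine t) eq (proj₂ (lineThrough t))) (proj₂ (lineThrough t′))

hasTermRank : ∀ {n} {A : Matrix n} {a b} → IndependentNonzeros A (a + b) → CoveredByLines A a b →
  HasTermRank A (a + b)
hasTermRank independent covered = record
  { attained = independent
  ; maximal  = λ _ → independent≤lines covered
  }

splitAt-injective : ∀ a b → Injective _≡_ _≡_ (splitAt a {b})
splitAt-injective a b {i} {j} eq = begin
  i                      ≡⟨ Finₚ.join-splitAt a b i ⟨
  join a b (splitAt a i) ≡⟨ cong (join a b) eq ⟩
  join a b (splitAt a j) ≡⟨ Finₚ.join-splitAt a b j ⟩
  j                      ∎
  where open ≡-Reasoning

module KeyedMatrix {R C : Set} (E : R → C → ℤ) {n : ℕ} (rows : List R) (cols : List C)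
                   (rows-length : length rows ≡ n) (cols-length : length cols ≡ n) where

  rowKey : Fin n → R
  rowKey = lookupAt rows rows-length

  colKey : Fin n → C
  colKey = lookupAt cols cols-length

  rowIndex : ∀ {x} → x ∈ rows → Fin n
  rowIndex x∈rows = proj₁ (∈⇒lookupAt rows-length x∈rows)

  colIndex : ∀ {y} → y ∈ cols → Fin n
  colIndex y∈cols = proj₁ (∈⇒lookupAt cols-length y∈cols)

  rowKey-rowIndex : ∀ {x} (x∈rows : x ∈ rows) → rowKey (rowIndex x∈rows) ≡ x
  rowKey-rowIndex x∈rows = proj₂ (∈⇒lookupAt rows-length x∈rows)

  colKey-colIndex : ∀ {y} (y∈cols : y ∈ cols) → colKey (colIndex y∈cols) ≡ y
  colKey-colIndex y∈cols = proj₂ (∈⇒lookupAt cols-length y∈cols)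

  matrix : Matrix n
  matrix i j = E (rowKey i) (colKey j)

  isASM : (∀ x y → Entry01 (E x y)) →
    (∀ {x} → x ∈ rows → Alternating (nonzeros (map (E x) cols))) →
    (∀ {y} → y ∈ cols → Alternating (nonzeros (map (λ x → E x y) rows))) →
    IsASM matrix
  isASM entries rowsAlt colsAlt = record
    { entries = λ i j → entries (rowKey i) (colKey j)
    ; rows    = λ i → subst (Alternating ∘ nonzeros)
                  (sym (map-lookupAt cols cols-length (E (rowKey i))))
                  (rowsAlt (lookupAt-∈ rows-length i))
    ; cols    = λ j → subst (Alternating ∘ nonzeros)
                  (sym (map-lookupAt rows rows-length (λ x → E x (colKey j))))
                  (colsAlt (lookupAt-∈ cols-length j))
    }

  independentNonzeros : ∀ {k} (p : Fin k → R) (q : Fin k → C) →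
    Injective _≡_ _≡_ p → Injective _≡_ _≡_ q →
    (p∈rows : ∀ t → p t ∈ rows) (q∈cols : ∀ t → q t ∈ cols) →
    (∀ t → E (p t) (q t) ≢ + 0) → IndependentNonzeros matrix k
  independentNonzeros {k} p q p-inj q-inj p∈rows q∈cols nonzero =
    r , c , r-inj , c-inj , λ t → subst₂ (λ x y → E x y ≢ + 0) (sym (r-key t)) (sym (c-key t)) (nonzero t)
    where
      r : Fin k → Fin n
      r t = rowIndex (p∈rows t)

      c : Fin k → Fin n
      c t = colIndex (q∈cols t)

      r-key : ∀ t → rowKey (r t) ≡ p t
      r-key t = rowKey-rowIndex (p∈rows t)

      c-key : ∀ t → colKey (c t) ≡ q t
      c-key t = colKey-colIndex (q∈cols t)

      r-inj : Injective _≡_ _≡_ r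
      r-inj eq = p-inj (trans (sym (r-key _)) (trans (cong rowKey eq) (r-key _)))
      c-inj : Injective _≡_ _≡_ c
      c-inj eq = q-inj (trans (sym (c-key _)) (trans (cong colKey eq) (c-key _)))

  coveredByLines : Unique rows → Unique cols →
    ∀ {a b} (ρ : Fin a → R) (γ : Fin b → C) (ρ∈rows : ∀ g → ρ g ∈ rows) (γ∈cols : ∀ h → γ h ∈ cols) →
    (∀ {x y} → x ∈ rows → y ∈ cols → E x y ≢ + 0 → (∃ λ g → ρ g ≡ x) ⊎ (∃ λ h → γ h ≡ y)) →
    CoveredByLines matrix a b
  coveredByLines rows-unique cols-unique ρ γ ρ∈rows γ∈cols cover =
    rowIndex ∘ ρ∈rows , colIndex ∘ γ∈cols , cover′
    where
      cover′ : ∀ i j → matrix i j ≢ + 0 →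
        (∃ λ g → rowIndex (ρ∈rows g) ≡ i) ⊎ (∃ λ h → colIndex (γ∈cols h) ≡ j)
      cover′ i j nonzero with cover (lookupAt-∈ rows-length i) (lookupAt-∈ cols-length j) nonzero
      ... | inj₁ (g , ρg≡x) = inj₁ (g , lookupAt-injective rows-length rows-unique
                                           (trans (rowKey-rowIndex (ρ∈rows g)) ρg≡x))
      ... | inj₂ (h , γh≡y) = inj₂ (h , lookupAt-injective cols-length cols-unique
                                           (trans (colKey-colIndex (γ∈cols h)) γh≡y))

δ : ℕ → ℕ → ℤ
δ zero    zero    = + 1
δ (suc x) (suc y) = δ x y
δ _       _       = + 0

δ-refl : ∀ x → δ x x ≡ + 1
δ-refl zero    = refl
δ-refl (suc x) = δ-refl x

δ-≢ : ∀ {x y} → x ≢ y → δ x y ≡ + 0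
δ-≢ {zero}  {zero}  x≢y = ⊥-elim (x≢y refl)
δ-≢ {zero}  {suc y} _   = refl
δ-≢ {suc x} {zero}  _   = refl
δ-≢ {suc x} {suc y} x≢y = δ-≢ (x≢y ∘ cong suc)

δ-sym : ∀ x y → δ x y ≡ δ y x
δ-sym zero    zero    = refl
δ-sym zero    (suc y) = refl
δ-sym (suc x) zero    = refl
δ-sym (suc x) (suc y) = δ-sym x y

Entry01-δ : ∀ x y → Entry01 (δ x y)
Entry01-δ zero    zero    = inj₂ (inj₁ refl)
Entry01-δ zero    (suc y) = inj₁ refl
Entry01-δ (suc x) zero    = inj₁ refl
Entry01-δ (suc x) (suc y) = Entry01-δ x y

nonzeros-δ-filterᵇ : ∀ (p : ℕ → Bool) {u n} → u < n →
  nonzeros (map (δ u) (filterᵇ p (upTo n))) ≡ (if p u then [ + 1 ] else [])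
nonzeros-δ-filterᵇ p {u} {n} u<n with p u in pu
... | true  = trans (nonzeros-map-single (δ u) (Unique.filter⁺ (T? ∘ p) (Unique.upTo⁺ n))
                      (∈-filter⁺ (T? ∘ p) (∈-upTo⁺ u<n) (subst T (sym pu) tt))
                      (λ t t≢u → δ-≢ {u} {t} (t≢u ∘ sym)))
                    (cong (nonzeros ∘ [_]) (δ-refl u))
... | false = nonzeros-map-zero (δ u) (All.map off-diagonal (All.all-filter (T? ∘ p) (upTo n)))
  where
    off-diagonal : ∀ {t} → T (p t) → δ u t ≡ + 0
    off-diagonal {t} pt = δ-≢ {u} {t} λ { refl → subst T pu pt }

minusOneIf : Bool → ℤ
minusOneIf true  = -[1+ 0 ]
minusOneIf false = + 0

Key : Set
Key = ℕ × ℕ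

-- P u v decides whether the interior pair (u + 1 , v + 1) belongs to K.
isKey : (ℕ → ℕ → Bool) → Key → Bool
isKey P (zero  , zero)  = false
isKey P (zero  , suc v) = true
isKey P (suc u , zero)  = true
isKey P (suc u , suc v) = P u v

entry : (ℕ → ℕ → Bool) → Key → Key → ℤ
entry P (u     , zero)  (suc u′ , _)     = δ u (suc u′)
entry P (_     , suc v) (zero   , v′)    = δ (suc v) v′
entry P (_     , suc _) (suc _  , _)     = + 0
entry P (suc u , zero)  (zero   , suc v) = minusOneIf (P u v)
entry P (_     , zero)  (zero   , _)     = + 0

rows : ℕ → ℕ → (ℕ → ℕ → Bool) → List Key
rows a b P = filterᵇ (isKey P) (cartesianProduct (upTo (suc a)) (upTo (suc b)))

cols : ℕ → ℕ → (ℕ → ℕ → Bool) → List Key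
cols a b P = map swap (rows b a (flip P))

isKey-flip : ∀ P x → isKey (flip P) (swap x) ≡ isKey P x
isKey-flip P (zero  , zero)  = refl
isKey-flip P (zero  , suc v) = refl
isKey-flip P (suc u , zero)  = refl
isKey-flip P (suc u , suc v) = refl

entry-transpose : ∀ P x y → entry P x y ≡ entry (flip P) (swap y) (swap x)
entry-transpose P (u     , zero)  (suc u′ , v′)    = δ-sym u (suc u′)
entry-transpose P (u     , suc v) (zero   , v′)    = δ-sym (suc v) v′
entry-transpose P (u     , suc v) (suc u′ , v′)    = refl
entry-transpose P (zero  , zero)  (zero   , zero)  = refl
entry-transpose P (zero  , zero)  (zero   , suc v) = refl
entry-transpose P (suc u , zero)  (zero   , zero)  = refl
entry-transpose P (suc u , zero)  (zero   , suc v) = refl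

Entry01-entry : ∀ P x y → Entry01 (entry P x y)
Entry01-entry P (u     , zero)  (suc u′ , v′)    = Entry01-δ u (suc u′)
Entry01-entry P (u     , suc v) (zero   , v′)    = Entry01-δ (suc v) v′
Entry01-entry P (u     , suc v) (suc u′ , v′)    = inj₁ refl
Entry01-entry P (zero  , zero)  (zero   , v′)    = inj₁ refl
Entry01-entry P (suc u , zero)  (zero   , zero)  = inj₁ refl
Entry01-entry P (suc u , zero)  (zero   , suc v) with P u v
... | true  = inj₂ (inj₂ refl)
... | false = inj₁ refl

IsKey : ℕ → ℕ → (ℕ → ℕ → Bool) → Key → Set
IsKey a b P (u , v) = u ≤ a × v ≤ b × T (isKey P (u , v))

∈-rows⁺ : ∀ a b P {x} → IsKey a b P x → x ∈ rows a b P
∈-rows⁺ a b P (u≤a , v≤b , kept) =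
  ∈-filter⁺ (T? ∘ isKey P) (∈-cartesianProduct⁺ (∈-upTo⁺ (s≤s u≤a)) (∈-upTo⁺ (s≤s v≤b))) kept

∈-rows⁻ : ∀ a b P {x} → x ∈ rows a b P → IsKey a b P x
∈-rows⁻ a b P x∈rows with ∈-filter⁻ (T? ∘ isKey P) x∈rows
... | x∈product , kept with ∈-cartesianProduct⁻ (upTo (suc a)) (upTo (suc b)) x∈product
...   | u∈ , v∈ = ≤-pred (∈-upTo⁻ u∈) , ≤-pred (∈-upTo⁻ v∈) , kept

∈-cols⁺ : ∀ a b P {x} → IsKey a b P x → x ∈ cols a b P
∈-cols⁺ a b P {x} (u≤a , v≤b , kept) =
  ∈-map⁺ swap (∈-rows⁺ b a (flip P) (v≤b , u≤a , subst T (sym (isKey-flip P x)) kept))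

∈-cols⁻ : ∀ a b P {x} → x ∈ cols a b P → IsKey a b P x
∈-cols⁻ a b P x∈cols with ∈-map⁻ swap x∈cols
... | z , z∈rows , refl with ∈-rows⁻ b a (flip P) z∈rows
...   | v≤b , u≤a , kept = u≤a , v≤b , subst T (isKey-flip P (swap z)) kept

rows-unique : ∀ a b P → Unique (rows a b P)
rows-unique a b P = Unique.filter⁺ (T? ∘ isKey P) (Unique.cartesianProduct⁺ (Unique.upTo⁺ (suc a)) (Unique.upTo⁺ (suc b)))

cols-unique : ∀ a b P → Unique (cols a b P)
cols-unique a b P = Unique.map⁺ (cong swap) (rows-unique b a (flip P))

length-cols : ∀ a b P → length (cols a b P) ≡ length (rows a b P)
length-cols a b P = unique∧sameMembers⇒length≡ (cols-unique a b P) (rows-unique a b P) (∈-rows⁺ a b P ∘ ∈-cols⁻ a b P) (∈-cols⁺ a b P ∘ ∈-rows⁻ a b P)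

columnBlock : (ℕ → ℕ → Bool) → ℕ → ℕ → Key → List ℤ
columnBlock P a v x = map (λ t → entry P x (t , v)) (filterᵇ (λ t → isKey (flip P) (v , t)) (upTo (suc a)))

nonzeros-columnBlock-zero : ∀ P {a u} → u < a → nonzeros (columnBlock P a 0 (suc u , 0)) ≡ [ + 1 ]
nonzeros-columnBlock-zero P {a} {u} u<a = begin
  nonzeros (columnBlock P a 0 (suc u , 0))
    ≡⟨ cong nonzeros (map-filterᵇ-upTo-suc (λ t → entry P (suc u , 0) (t , 0)) (λ t → isKey (flip P) (0 , t)) a) ⟩
  nonzeros (map (δ u) (filterᵇ (λ _ → true) (upTo a)))
    ≡⟨ nonzeros-δ-filterᵇ (λ _ → true) u<a ⟩
  [ + 1 ] ∎
  where open ≡-Reasoning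

nonzeros-columnBlock-suc : ∀ P {a u} w → u < a →
  nonzeros (columnBlock P a (suc w) (suc u , 0)) ≡ signPair (P u w)
nonzeros-columnBlock-suc P {a} {u} w u<a = begin
  nonzeros (columnBlock P a (suc w) (suc u , 0))
    ≡⟨ cong nonzeros (map-filterᵇ-upTo-suc (λ t → entry P (suc u , 0) (t , suc w)) (λ t → isKey (flip P) (suc w , t)) a) ⟩
  nonzeros ([ minusOneIf (P u w) ] ++ map (δ u) (filterᵇ (λ t → P t w) (upTo a)))
    ≡⟨ nonzeros-++ [ minusOneIf (P u w) ] _ ⟩
  nonzeros [ minusOneIf (P u w) ] ++ nonzeros (map (δ u) (filterᵇ (λ t → P t w) (upTo a)))
    ≡⟨ cong (nonzeros [ minusOneIf (P u w) ] ++_) (nonzeros-δ-filterᵇ (λ t → P t w) u<a) ⟩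
  nonzeros [ minusOneIf (P u w) ] ++ (if P u w then [ + 1 ] else [])
    ≡⟨ signPair-≡ (P u w) ⟩
  signPair (P u w) ∎
  where
    open ≡-Reasoning
    signPair-≡ : ∀ s → nonzeros [ minusOneIf s ] ++ (if s then [ + 1 ] else []) ≡ signPair s
    signPair-≡ true  = refl
    signPair-≡ false = refl

nonzeros-axisRow : ∀ a b P {u} → u < a →
  nonzeros (map (entry P (suc u , 0)) (cols a b P)) ≡ + 1 ∷ concatMap (signPair ∘ P u) (upTo b)
nonzeros-axisRow a b P {u} u<a = begin
  nonzeros (map (entry P x) (map swap (rows b a (flip P))))
    ≡⟨ cong nonzeros (sym (List.map-∘ (rows b a (flip P)))) ⟩
  nonzeros (map (entry P x ∘ swap) (rows b a (flip P)))
    ≡⟨ cong nonzeros (map-filterᵇ-cartesianProduct (entry P x ∘ swap) (isKey (flip P)) (upTo (suc b)) (upTo (suc a))) ⟩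
  nonzeros (concatMap (λ v → columnBlock P a v x) (upTo (suc b)))
    ≡⟨ nonzeros-concatMap (λ v → columnBlock P a v x) (upTo (suc b)) ⟩
  concatMap (λ v → nonzeros (columnBlock P a v x)) (upTo (suc b))
    ≡⟨ cong (concatMap (λ v → nonzeros (columnBlock P a v x))) (upTo-suc b) ⟩
  nonzeros (columnBlock P a 0 x) ++ concatMap (λ v → nonzeros (columnBlock P a v x)) (map suc (upTo b))
    ≡⟨ cong₂ _++_ (nonzeros-columnBlock-zero P u<a)
                   (trans (List.concatMap-map _ suc (upTo b))
                          (List.concatMap-cong (λ w → nonzeros-columnBlock-suc P w u<a) (upTo b))) ⟩
  + 1 ∷ concatMap (signPair ∘ P u) (upTo b) ∎
  where
    open ≡-Reasoning
    x = (suc u , 0)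

rows-alternate : ∀ a b P {x} → x ∈ rows a b P → Alternating (nonzeros (map (entry P x) (cols a b P)))
rows-alternate a b P {zero , zero} x∈rows with () ← proj₂ (proj₂ (∈-rows⁻ a b P x∈rows))
rows-alternate a b P {suc u , zero} x∈rows =
  subst Alternating (sym (nonzeros-axisRow a b P (proj₁ (∈-rows⁻ a b P x∈rows))))
    (alternating-signPairs (P u) (upTo b))
rows-alternate a b P {u , suc v} x∈rows =
  subst Alternating (sym (trans
    (nonzeros-map-single (entry P (u , suc v)) (cols-unique a b P)
      (∈-cols⁺ a b P (z≤n , proj₁ (proj₂ (∈-rows⁻ a b P x∈rows)) , tt)) vanishes)
    (cong (nonzeros ∘ [_]) (δ-refl v))))
    single
  where
    vanishes : ∀ y → y ≢ (0 , suc v) → entry P (u , suc v) y ≡ + 0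
    vanishes (zero   , v′) y≢ = δ-≢ {suc v} {v′} λ { refl → y≢ refl }
    vanishes (suc u′ , v′) _  = refl

cols-alternate : ∀ a b P {y} → y ∈ cols a b P → Alternating (nonzeros (map (λ x → entry P x y) (rows a b P)))
cols-alternate a b P y∈cols with ∈-map⁻ swap y∈cols
... | z , z∈rows , refl =
  subst (Alternating ∘ nonzeros) (sym column≡row) (rows-alternate b a (flip P) z∈rows)
  where
    column≡row : map (λ x → entry P x (swap z)) (rows a b P) ≡ map (entry (flip P) z) (cols b a (flip P))
    column≡row = trans (List.map-cong (λ x → entry-transpose P x (swap z)) (rows a b P)) (List.map-∘ (rows a b P))

rowAxisKey : ∀ {a} → Fin a → Key
rowAxisKey g = (suc (toℕ g) , 0)

colAxisKey : ∀ {b} → Fin b → Key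
colAxisKey h = (0 , suc (toℕ h))

axisKey : ∀ {a b} → Fin a ⊎ Fin b → Key
axisKey (inj₁ g) = rowAxisKey g
axisKey (inj₂ h) = colAxisKey h

axisKey-injective : ∀ {a b} → Injective _≡_ _≡_ (axisKey {a} {b})
axisKey-injective {x = inj₁ g} {inj₁ g′} eq = cong inj₁ (Finₚ.toℕ-injective (suc-injective (cong proj₁ eq)))
axisKey-injective {x = inj₂ h} {inj₂ h′} eq = cong inj₂ (Finₚ.toℕ-injective (suc-injective (cong proj₂ eq)))
axisKey-injective {x = inj₁ g} {inj₂ h′} ()
axisKey-injective {x = inj₂ h} {inj₁ g′} ()

axisKey-isKey : ∀ a b P (s : Fin a ⊎ Fin b) → IsKey a b P (axisKey s)
axisKey-isKey a b P (inj₁ g) = Finₚ.toℕ<n g , z≤n , tt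
axisKey-isKey a b P (inj₂ h) = z≤n , Finₚ.toℕ<n h , tt

entry-axisKey : ∀ P {a b} (s : Fin a ⊎ Fin b) → entry P (axisKey s) (axisKey s) ≡ + 1
entry-axisKey P (inj₁ g) = δ-refl (toℕ g)
entry-axisKey P (inj₂ h) = δ-refl (toℕ h)

rowAxisKey-onto : ∀ a b P {u} → (u , 0) ∈ rows a b P → ∃ λ (g : Fin a) → rowAxisKey g ≡ (u , 0)
rowAxisKey-onto a b P {zero}  x∈rows with () ← proj₂ (proj₂ (∈-rows⁻ a b P x∈rows))
rowAxisKey-onto a b P {suc u} x∈rows =
  fromℕ< u<a , cong (λ t → (suc t , 0)) (Finₚ.toℕ-fromℕ< u<a)
  where u<a = proj₁ (∈-rows⁻ a b P x∈rows)

colAxisKey-onto : ∀ a b P {v} → (0 , v) ∈ cols a b P → ∃ λ (h : Fin b) → colAxisKey h ≡ (0 , v)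
colAxisKey-onto a b P {zero}  y∈cols with () ← proj₂ (proj₂ (∈-cols⁻ a b P y∈cols))
colAxisKey-onto a b P {suc v} y∈cols =
  fromℕ< v<b , cong (λ t → (0 , suc t)) (Finₚ.toℕ-fromℕ< v<b)
  where v<b = proj₁ (proj₂ (∈-cols⁻ a b P y∈cols))

axes-cover : ∀ a b P {x y} → x ∈ rows a b P → y ∈ cols a b P → entry P x y ≢ + 0 →
  (∃ λ (g : Fin a) → rowAxisKey g ≡ x) ⊎ (∃ λ (h : Fin b) → colAxisKey h ≡ y)
axes-cover a b P {u , zero}  x∈rows _      _       = inj₁ (rowAxisKey-onto a b P x∈rows)
axes-cover a b P {u , suc v} {zero , v′} _ y∈cols _ = inj₂ (colAxisKey-onto a b P y∈cols)
axes-cover a b P {u , suc v} {suc u′ , v′} _ _ nonzero = ⊥-elim (nonzero refl)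

asmWithTermRank : ∀ a b P {n} → length (rows a b P) ≡ n →
  Σ (Matrix n) λ A → IsASM A × HasTermRank A (a + b)
asmWithTermRank a b P rows-length =
  matrix , isASM (Entry01-entry P) (rows-alternate a b P) (cols-alternate a b P) , hasTermRank diagonal covered
  where
    open KeyedMatrix (entry P) (rows a b P) (cols a b P) rows-length (trans (length-cols a b P) rows-length)

    onAxes : Fin (a + b) → Key
    onAxes = axisKey ∘ splitAt a

    onAxes-injective : Injective _≡_ _≡_ onAxes
    onAxes-injective = splitAt-injective a b ∘ axisKey-injective

    diagonal : IndependentNonzeros matrix (a + b)
    diagonal = independentNonzeros onAxes onAxes onAxes-injective onAxes-injective
      (λ t → ∈-rows⁺ a b P (axisKey-isKey a b P (splitAt a t)))
      (λ t → ∈-cols⁺ a b P (axisKey-isKey a b P (splitAt a t)))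
      (λ t eq → case trans (sym (entry-axisKey P (splitAt a t))) eq of λ ())

    covered : CoveredByLines matrix a b
    covered = coveredByLines (rows-unique a b P) (cols-unique a b P) rowAxisKey colAxisKey
      (λ g → ∈-rows⁺ a b P (axisKey-isKey a b P (inj₁ g)))
      (λ h → ∈-cols⁺ a b P (axisKey-isKey a b P (inj₂ h)))
      (axes-cover a b P)

length-rows : ∀ a b P →
  length (rows a b P) ≡ b + sum (map (λ u → suc (length (filterᵇ (P u) (upTo b)))) (upTo a))
length-rows a b P = begin
  length (rows a b P)
    ≡⟨ length-filterᵇ-cartesianProduct (isKey P) (upTo (suc a)) (upTo (suc b)) ⟩
  sum (map rowLength (upTo (suc a)))
    ≡⟨ cong (sum ∘ map rowLength) (upTo-suc a) ⟩
  rowLength 0 + sum (map rowLength (map suc (upTo a)))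
    ≡⟨ cong₂ _+_ rowLength-zero (cong sum (trans (sym (List.map-∘ (upTo a))) (List.map-cong rowLength-suc (upTo a)))) ⟩
  b + sum (map (λ u → suc (length (filterᵇ (P u) (upTo b)))) (upTo a)) ∎
  where
    open ≡-Reasoning
    rowLength : ℕ → ℕ
    rowLength u = length (filterᵇ (λ v → isKey P (u , v)) (upTo (suc b)))

    rowLength-zero : rowLength 0 ≡ b
    rowLength-zero = begin
      rowLength 0                                     ≡⟨ length-filterᵇ-upTo-suc (λ v → isKey P (0 , v)) b ⟩
      length (filterᵇ (λ _ → true) (upTo b))          ≡⟨ cong length (List.filter-all (T? ∘ λ _ → true) (All.universal _ (upTo b))) ⟩
      length (upTo b)                                 ≡⟨ List.length-upTo b ⟩
      b                                               ∎

    rowLength-suc : ∀ u → rowLength (suc u) ≡ suc (length (filterᵇ (P u) (upTo b)))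
    rowLength-suc u = length-filterᵇ-upTo-suc (λ v → isKey P (suc u , v)) b

staircase : (ℕ → ℕ) → ℕ → ℕ → Bool
staircase c u v = v <ᵇ c u

length-rows-staircase : ∀ a b (c : ℕ → ℕ) → (∀ u → c u ≤ b) →
  length (rows a b (staircase c)) ≡ a + b + sum (map c (upTo a))
length-rows-staircase a b c c≤b = begin
  length (rows a b (staircase c))
    ≡⟨ length-rows a b (staircase c) ⟩
  b + sum (map (λ u → suc (length (filterᵇ (_<ᵇ c u) (upTo b)))) (upTo a))
    ≡⟨ cong (λ xs → b + sum xs) (List.map-cong rowCount (upTo a)) ⟩
  b + sum (map (suc ∘ c) (upTo a))
    ≡⟨ cong (_+_ b) (sum-map-suc c (upTo a)) ⟩
  b + (length (upTo a) + sum (map c (upTo a)))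
    ≡⟨ cong (λ l → b + (l + sum (map c (upTo a)))) (List.length-upTo a) ⟩
  b + (a + sum (map c (upTo a)))
    ≡⟨ solve 3 (λ a b s → b :+ (a :+ s) := a :+ b :+ s) refl a b (sum (map c (upTo a))) ⟩
  a + b + sum (map c (upTo a)) ∎
  where
    open ≡-Reasoning
    rowCount : ∀ u → suc (length (filterᵇ (_<ᵇ c u) (upTo b))) ≡ suc (c u)
    rowCount u = cong suc (trans (cong length (filterᵇ-<ᵇ-upTo (c≤b u))) (List.length-upTo (c u)))

boundedParts : ∀ a b e → e ≤ a * b → Σ (ℕ → ℕ) λ c → (∀ u → c u ≤ b) × sum (map c (upTo a)) ≡ e
boundedParts zero    b e e≤0 = (λ _ → 0) , (λ _ → z≤n) , sym (n≤0⇒n≡0 e≤0)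
boundedParts (suc a) b e e≤b+ab
  with boundedParts a b (e ∸ b) (≤-trans (∸-monoˡ-≤ b e≤b+ab) (≤-reflexive (m+n∸m≡n b (a * b))))
... | c′ , c′≤b , sum≡ = c , c≤b , sum-c
  where
    c : ℕ → ℕ
    c zero    = b ⊓ e
    c (suc u) = c′ u

    c≤b : ∀ u → c u ≤ b
    c≤b zero    = m⊓n≤m b e
    c≤b (suc u) = c′≤b u

    sum-c : sum (map c (upTo (suc a))) ≡ e
    sum-c = begin
      sum (map c (upTo (suc a)))               ≡⟨ cong (sum ∘ map c) (upTo-suc a) ⟩
      b ⊓ e + sum (map c (map suc (upTo a)))   ≡⟨ cong (λ xs → b ⊓ e + sum xs) (List.map-∘ (upTo a)) ⟨
      b ⊓ e + sum (map c′ (upTo a))            ≡⟨ cong (_+_ (b ⊓ e)) sum≡ ⟩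
      b ⊓ e + (e ∸ b)                          ≡⟨ m⊓n+n∸m≡n b e ⟩
      e                                        ∎
      where open ≡-Reasoning

balancedSplit : ∀ m → Σ ℕ λ a → Σ ℕ λ b → a + b ≡ m × (b ≡ a ⊎ b ≡ suc a)
balancedSplit zero = 0 , 0 , refl , inj₁ refl
balancedSplit (suc m) with balancedSplit m
... | a , b , a+b≡m , balanced = b , suc a , trans (+-suc b a) (cong suc (trans (+-comm b a) a+b≡m)) , rebalance balanced
  where
    rebalance : ∀ {a b} → b ≡ a ⊎ b ≡ suc a → suc a ≡ b ⊎ suc a ≡ suc b
    rebalance (inj₁ b≡a)  = inj₂ (cong suc (sym b≡a))
    rebalance (inj₂ b≡1+a) = inj₁ (sym b≡1+a)

[a+b+2]²≤4[a+1][b+1]+1 : ∀ {a b} → b ≡ a ⊎ b ≡ suc a → (a + b + 2) * (a + b + 2) ≤ 4 * ((a + 1) * (b + 1)) + 1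
[a+b+2]²≤4[a+1][b+1]+1 {a} (inj₁ refl) = ≤-trans (≤-reflexive (square a)) (m≤m+n _ 1)
  where
    square : ∀ a → (a + a + 2) * (a + a + 2) ≡ 4 * ((a + 1) * (a + 1))
    square = solve 1 (λ a → (a :+ a :+ con 2) :* (a :+ a :+ con 2) := con 4 :* ((a :+ con 1) :* (a :+ con 1))) refl
[a+b+2]²≤4[a+1][b+1]+1 {a} (inj₂ refl) = ≤-reflexive (square a)
  where
    square : ∀ a → (a + suc a + 2) * (a + suc a + 2) ≡ 4 * ((a + 1) * (suc a + 1)) + 1
    square = solve 1 (λ a → (a :+ (con 1 :+ a) :+ con 2) :* (a :+ (con 1 :+ a) :+ con 2)
                         := con 4 :* ((a :+ con 1) :* ((con 1 :+ a) :+ con 1)) :+ con 1) refl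

4m≤4n+1⇒m≤n : ∀ m n → 4 * m ≤ 4 * n + 1 → m ≤ n
4m≤4n+1⇒m≤n m n 4m≤4n+1 = ≤-pred (*-cancelˡ-< 4 m (suc n) (≤-<-trans 4m≤4n+1 4n+1<4[n+1]))
  where
    4n+1<4[n+1] : 4 * n + 1 < 4 * suc n
    4n+1<4[n+1] = subst (4 * n + 1 <_) (solve 1 (λ n → con 4 :* n :+ con 4 := con 4 :* (con 1 :+ n)) refl n)
                    (+-monoʳ-< (4 * n) (s≤s (s≤s z≤n)))

ceil2Sqrt-split : ∀ n m → IsCeil2Sqrt n m →
  Σ ℕ λ a → Σ ℕ λ b → a + b ≡ m × a + b ≤ n × n ∸ (a + b) ≤ a * b
ceil2Sqrt-split n m (upper , least) with balancedSplit m
... | a , b , refl , balanced = a , b , refl , a+b≤n , excess≤ab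
  where
    a+b≤n : a + b ≤ n
    a+b≤n = least n (subst (4 * (n + 1) ≤_)
      (solve 1 (λ n → con 4 :* (n :+ con 1) :+ n :* n := (n :+ con 2) :* (n :+ con 2)) refl n)
      (m≤m+n (4 * (n + 1)) (n * n)))

    n+1≤[a+1][b+1] : n + 1 ≤ (a + 1) * (b + 1)
    n+1≤[a+1][b+1] = 4m≤4n+1⇒m≤n (n + 1) ((a + 1) * (b + 1)) (≤-trans upper ([a+b+2]²≤4[a+1][b+1]+1 balanced))

    n≤a+b+ab : n ≤ a + b + a * b
    n≤a+b+ab = ≤-pred (subst₂ _≤_ (+-comm n 1)
      (solve 2 (λ a b → (a :+ con 1) :* (b :+ con 1) := con 1 :+ (a :+ b :+ a :* b)) refl a b)
      n+1≤[a+1][b+1])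

    excess≤ab : n ∸ (a + b) ≤ a * b
    excess≤ab = ≤-trans (∸-monoˡ-≤ (a + b) n≤a+b+ab) (≤-reflexive (m+n∸m≡n (a + b) (a * b)))

mainTheorem5 : ∀ (n : ℕ) → 1 ≤ n → ∀ (m : ℕ) → IsCeil2Sqrt n m →
    Σ (Matrix n) λ A → IsASM A × HasTermRank A m
mainTheorem5 n _ m ceil with ceil2Sqrt-split n m ceil
... | a , b , refl , a+b≤n , excess≤ab with boundedParts a b (n ∸ (a + b)) excess≤ab
...   | c , c≤b , sum-c≡excess = asmWithTermRank a b (staircase c) (begin
  length (rows a b (staircase c))        ≡⟨ length-rows-staircase a b c c≤b ⟩
  a + b + sum (map c (upTo a))           ≡⟨ cong (_+_ (a + b)) sum-c≡excess ⟩
  a + b + (n ∸ (a + b))                  ≡⟨ m+[n∸m]≡n a+b≤n ⟩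
  n                                      ∎)
  where open ≡-Reasoning
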